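{- Let $n\ge1$, let $\sigma$ be a permutation of $[n]$, let $1\le i\le n+1$, and let $\pi$ be the permutation of $[n+1]$ obtained by inserting $n+1$ into $\sigma$ at position $i$ (immediately before $\sigma_i$ if $i\le n$, at the end if $i=n+1$). Let $\ell\in\{a,x,y\}$ be the label of position $i$ in the $A$-labeling of $\sigma$, and let $G(\ell)$ be its image under the substitution rules $a\to ax$, $x\to xy$, $y\to x^2$. Then the weight of $\pi$ equals $\mathrm{wt}(\sigma)\cdot G(\ell)/\ell$, i.e. it is obtained from the weight of $\sigma$ by applying the substitution rule to the label at position $i$.
   Context: For a permutation $\sigma=\sigma_1\cdots\sigma_n$, position $j$ ($1\le j\le n$) is the slot immediately before $\sigma_j$ and position $n+1$ is the slot after $\sigma_n$. Set $\sigma_0=0$. The $A$-labeling assigns to each position $1,\dots,n+1$ one label from $\{a,x,y\}$ as follows, considering the maximal monotone segments (runs) $\sigma_i\sigma_{i+1}\cdots\sigma_j$ ($0\le i<j\le n$) of $\sigma_0\sigma_1\cdots\sigma_n$. For an increasing run with $j<n$: positions $i+1,\dots,j-1$ get $y$ and position $j$ gets $x$. For an increasing run with $j=n$: position $n$ gets $a$, position $n+1$ gets $x$, and positions $i+1,\dots,n-1$ get $y$. For a decreasing run: position $i+1$ gets $x$ and positions $i+2,\dots,j$ get $y$; if moreover $j=n$, position $n+1$ gets $a$. (Example: $\sigma=3\,7\,5\,8\,6\,1\,4\,9\,2$ is labeled $0\,y\,3\,x\,7\,x\,5\,x\,8\,x\,6\,y\,1\,y\,4\,x\,9\,x\,2\,a$.)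 The weight $\mathrm{wt}(\sigma)$ is the product of all labels, a monomial in $a,x,y$. -}

module Defs where

open import Data.Nat using (ℕ; zero; suc; _+_; _∸_; _<ᵇ_)
open import Data.Bool using (if_then_else_)
open import Data.List using (List; []; _∷_; _++_; take; drop; replicate; foldr)
open import Data.Maybe using (Maybe; just; nothing)
open import Data.Product using (_×_; _,_)

data Label : Set where
  a x y : Label

-- Monomials a^p x^q y^r, represented by their exponent triple (p , q , r);
-- multiplication of monomials is componentwise addition of exponents.
Mono : Set
Mono = ℕ × ℕ × ℕ

_·_ : Mono → Mono → Mono
(p , q , r) · (p' , q' , r') = (p + p' , q + q' , r + r')

one : Mono
one = (0 , 0 , 0)

mono : Label → Mono
mono a = (1 , 0 , 0)
mono x = (0 , 1 , 0)
mono y = (0 , 0 , 1)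

G : Label → Mono
G a = (1 , 1 , 0)
G x = (0 , 1 , 1)
G y = (0 , 2 , 0)

data Dir : Set where
  up down : Dir

dirs : List ℕ → List Dir
dirs (u ∷ rest@(v ∷ _)) = (if u <ᵇ v then up else down) ∷ dirs rest
dirs _ = []

-- Maximal runs: (direction , k) means a run with k+1 steps
addStep : Dir → List (Dir × ℕ) → List (Dir × ℕ)
addStep up   ((up   , k) ∷ rs) = (up   , suc k) ∷ rs
addStep down ((down , k) ∷ rs) = (down , suc k) ∷ rs
addStep d rs = (d , 0) ∷ rs

runs : List Dir → List (Dir × ℕ)
runs = foldr addStep []

runLabels : Dir → ℕ → Label → List Label
runLabels up   k _ = replicate k y ++ x ∷ []
runLabels down k _ = x ∷ replicate k y

lastRunLabels : Dir → ℕ → List Label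
lastRunLabels up   k = replicate k y ++ a ∷ x ∷ []
lastRunLabels down k = x ∷ replicate k y ++ a ∷ []

labelsOfRuns : List (Dir × ℕ) → List Label
labelsOfRuns [] = []
labelsOfRuns ((d , k) ∷ []) = lastRunLabels d k
labelsOfRuns ((d , k) ∷ rs@(_ ∷ _)) = runLabels d k a ++ labelsOfRuns rs

-- The A-labeling of σ: list of labels of positions 1, …, n+1,
-- computed from the maximal monotone runs of σ₀σ₁⋯σₙ with σ₀ = 0.
Alabeling : List ℕ → List Label
Alabeling σ = labelsOfRuns (runs (dirs (0 ∷ σ)))

-- Label at position i (1-based)
labelAt : List Label → ℕ → Maybe Label
labelAt [] _ = nothing
labelAt (l ∷ ls) zero = nothing
labelAt (l ∷ ls) (suc zero) = just l
labelAt (l ∷ ls) (suc (suc i)) = labelAt ls (suc i)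

wt : List ℕ → Mono
wt σ = foldr (λ l m → mono l · m) one (Alabeling σ)

insertMax : ℕ → ℕ → List ℕ → List ℕ
insertMax n i σ = take (i ∸ 1) σ ++ suc n ∷ drop (i ∸ 1) σ

-- Every label of the A-labeling is determined locally by the steps of 0σ₁⋯σₙ: a descent
-- is labelled x right after an ascent and y after a descent, an ascent is labelled by the
-- next step (y before an ascent, x before a descent, a at the end), and the extra last
-- position carries x after an ascent and a after a descent.  Inserting the maximum n+1 at
-- position i replaces the step σᵢ₋₁σᵢ by an ascent followed by a descent (or appends an
-- ascent), so only a window of at most four labels changes, and a finite check on this
-- window shows that its weight changes exactly by the substitution ℓ → G(ℓ).
module Submission where

open import Defs
open import Data.Nat using (ℕ; zero; suc; _≤_; _<_; _<ᵇ_; s≤s; z≤n)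
open import Data.Nat.Properties using (<ᵇ-reflects-<; <-asym; +-comm; +-commutativeSemigroup)
open import Data.Bool using (true; false; if_then_else_)
open import Data.List using (List; []; _∷_; _++_; take; drop; map; upTo; foldr; head)
open import Data.List.Relation.Unary.All as All using (All; _∷_; [])
open import Data.List.Membership.Propositional using (_∈_)
open import Data.List.Relation.Unary.Any using (here)
open import Data.List.Membership.Propositional.Properties using (∈-map⁻; ∈-upTo⁻)
open import Data.List.Relation.Binary.Permutation.Propositional using (_↭_)
open import Data.List.Relation.Binary.Permutation.Propositional.Properties using (∈-resp-↭)
open import Data.Maybe using (Maybe; just; nothing)
open import Data.Product using (_×_; _,_; proj₂; ∃₂)
open import Data.Empty using (⊥-elim)
open import Function using (_$_)
open import Relation.Nullary.Reflects using (ofʸ; ofⁿ)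
open import Relation.Binary.PropositionalEquality
  using (_≡_; refl; sym; trans; cong; cong₂; module ≡-Reasoning)
open import Algebra.Properties.CommutativeSemigroup +-commutativeSemigroup using (x∙yz≈y∙xz)

·-comm : ∀ m n → m · n ≡ n · m
·-comm (p , q , r) (p' , q' , r') = cong₂ _,_ (+-comm p p') (cong₂ _,_ (+-comm q q') (+-comm r r'))

·-left-comm : ∀ m n o → m · (n · o) ≡ n · (m · o)
·-left-comm (p , q , r) (p' , q' , r') (p'' , q'' , r'') =
  cong₂ _,_ (x∙yz≈y∙xz p p' p'') (cong₂ _,_ (x∙yz≈y∙xz q q' q'') (x∙yz≈y∙xz r r' r''))

weight : List Label → Mono
weight = foldr (λ l m → mono l · m) one

-- A record rather than an equation, so that ℓ, L and L' can be inferred from a goal.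
record Substitutes (ℓ : Label) (L L' : List Label) : Set where
  constructor substitutes
  field weight-eq : G ℓ · weight L ≡ mono ℓ · weight L'

substitutes-∷ : ∀ {ℓ} l {L L'} → Substitutes ℓ L L' → Substitutes ℓ (l ∷ L) (l ∷ L')
substitutes-∷ {ℓ} l {L} {L'} (substitutes eq) = substitutes $ begin
  G ℓ · (mono l · weight L)     ≡⟨ ·-left-comm (G ℓ) (mono l) (weight L) ⟩
  mono l · (G ℓ · weight L)     ≡⟨ cong (mono l ·_) eq ⟩
  mono l · (mono ℓ · weight L') ≡⟨ ·-left-comm (mono l) (mono ℓ) (weight L') ⟩
  mono ℓ · (mono l · weight L') ∎
  where open ≡-Reasoning

descentLabel : Dir → Label
descentLabel up   = x
descentLabel down = y

ascentLabel : Maybe Dir → Label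
ascentLabel nothing     = a
ascentLabel (just up)   = y
ascentLabel (just down) = x

stepLabel : Dir → Dir → Maybe Dir → Label
stepLabel p down _    = descentLabel p
stepLabel _ up   next = ascentLabel next

finalLabel : Dir → Label
finalLabel up   = x
finalLabel down = a

labelsAfter : Dir → List Dir → List Label
labelsAfter p []      = finalLabel p ∷ []
labelsAfter p (d ∷ D) = stepLabel p d (head D) ∷ labelsAfter d D

opposite : Dir → Dir
opposite up   = down
opposite down = up

ascent-run-grow : ∀ k R → labelsOfRuns ((up , suc k) ∷ R) ≡ y ∷ labelsOfRuns ((up , k) ∷ R)
ascent-run-grow k []      = refl
ascent-run-grow k (_ ∷ _) = refl

descent-run-grow : ∀ k R →
  labelsOfRuns ((down , suc k) ∷ R) ≡ x ∷ y ∷ drop 1 (labelsOfRuns ((down , k) ∷ R))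
descent-run-grow k []      = refl
descent-run-grow k (_ ∷ _) = refl

addStep-head : ∀ d rs → ∃₂ λ k R → addStep d rs ≡ (d , k) ∷ R
addStep-head up   []                = 0 , [] , refl
addStep-head up   ((up   , k) ∷ R)  = suc k , R , refl
addStep-head up   ((down , k) ∷ R)  = 0 , _ , refl
addStep-head down []                = 0 , [] , refl
addStep-head down ((up   , k) ∷ R)  = 0 , _ , refl
addStep-head down ((down , k) ∷ R)  = suc k , R , refl

addStep-labels : ∀ d e k R D →
  labelsOfRuns ((e , k) ∷ R) ≡ labelsAfter (opposite e) (e ∷ D) →
  labelsOfRuns (addStep d ((e , k) ∷ R)) ≡ labelsAfter (opposite d) (d ∷ e ∷ D)
addStep-labels up   up   k R D eq = trans (ascent-run-grow k R) (cong (y ∷_) eq)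
addStep-labels up   down k R D eq = cong (x ∷_) eq
addStep-labels down up   k R D eq = cong (x ∷_) eq
addStep-labels down down k R D eq =
  trans (descent-run-grow k R) (cong (λ L → x ∷ y ∷ drop 1 L) eq)

-- A run is labelled as if it were preceded by a step in the opposite direction.
runs-labelsAfter : ∀ d D → labelsOfRuns (runs (d ∷ D)) ≡ labelsAfter (opposite d) (d ∷ D)
runs-labelsAfter up   []      = refl
runs-labelsAfter down []      = refl
runs-labelsAfter d    (e ∷ D) with addStep-head e (runs D) | runs-labelsAfter e D
... | k , R , eq | ih rewrite eq = addStep-labels d e k R D ih

insertPeak : ℕ → List Dir → List Dir
insertPeak _       []      = up ∷ []
insertPeak zero    (_ ∷ D) = up ∷ down ∷ D
insertPeak (suc j) (d ∷ D) = d ∷ insertPeak j D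

-- The local identities hold by computation: every constant factor stands to the left of
-- the weight of the unchanged tail.
substitutes-peak-at-ascent : ∀ p D →
  Substitutes (ascentLabel (head D)) (labelsAfter p (up ∷ D)) (labelsAfter p (up ∷ down ∷ D))
substitutes-peak-at-ascent p []         = substitutes refl
substitutes-peak-at-ascent p (up ∷ D)   = substitutes refl
substitutes-peak-at-ascent p (down ∷ D) = substitutes refl

substitutes-insertPeak-after : ∀ p e D j ℓ → labelAt (labelsAfter e D) (suc j) ≡ just ℓ →
  Substitutes ℓ (labelsAfter p (e ∷ D)) (labelsAfter p (e ∷ insertPeak j D))
substitutes-insertPeak-after p up   []         zero    ℓ refl = substitutes refl
substitutes-insertPeak-after p down []         zero    ℓ refl =
  substitutes-∷ (descentLabel p) (substitutes refl)
substitutes-insertPeak-after p e    (up ∷ D)   zero    ℓ refl =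
  substitutes-∷ (stepLabel p e (just up)) (substitutes-peak-at-ascent e D)
substitutes-insertPeak-after p up   (down ∷ D) zero    ℓ refl = substitutes refl
substitutes-insertPeak-after p down (down ∷ D) zero    ℓ refl =
  substitutes-∷ (descentLabel p) (substitutes refl)
substitutes-insertPeak-after p e    (f ∷ D)    (suc j) ℓ eq   =
  substitutes-∷ (stepLabel p e (just f)) (substitutes-insertPeak-after e f D j ℓ eq)

substitutes-insertPeak : ∀ D j ℓ → labelAt (labelsOfRuns (runs (up ∷ D))) (suc j) ≡ just ℓ →
  Substitutes ℓ (labelsOfRuns (runs (up ∷ D))) (labelsOfRuns (runs (insertPeak j (up ∷ D))))
substitutes-insertPeak D zero ℓ eq
  rewrite runs-labelsAfter up D | runs-labelsAfter up (down ∷ D) with eq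
... | refl = substitutes-peak-at-ascent down D
substitutes-insertPeak D (suc j) ℓ eq
  rewrite runs-labelsAfter up D | runs-labelsAfter up (insertPeak j D) =
  substitutes-insertPeak-after down up D j ℓ eq

ascent-step : ∀ {u v} → u < v → (if u <ᵇ v then up else down) ≡ up
ascent-step {u} {v} u<v with u <ᵇ v | <ᵇ-reflects-< u v
... | true  | _        = refl
... | false | ofⁿ u≮v = ⊥-elim (u≮v u<v)

descent-step : ∀ {u v} → v < u → (if u <ᵇ v then up else down) ≡ down
descent-step {u} {v} v<u with u <ᵇ v | <ᵇ-reflects-< u v
... | true  | ofʸ u<v = ⊥-elim (<-asym u<v v<u)
... | false | _        = refl

dirs-insertMax : ∀ {M} j v τ → v < M → All (_< M) τ →
  dirs (v ∷ take j τ ++ M ∷ drop j τ) ≡ insertPeak j (dirs (v ∷ τ))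
dirs-insertMax zero    v []      v<M []          = cong (_∷ []) (ascent-step v<M)
dirs-insertMax zero    v (s ∷ τ) v<M (s<M ∷ _)   =
  cong₂ (λ d e → d ∷ e ∷ dirs (s ∷ τ)) (ascent-step v<M) (descent-step s<M)
dirs-insertMax (suc j) v []      v<M []          = cong (_∷ []) (ascent-step v<M)
dirs-insertMax (suc j) v (s ∷ τ) _   (s<M ∷ τ<M) = cong (_ ∷_) (dirs-insertMax j s τ s<M τ<M)

↭-range : ∀ {n σ u} → σ ↭ map suc (upTo n) → u ∈ σ → 0 < u × u < suc n
↭-range σ↭ u∈σ with ∈-map⁻ suc (∈-resp-↭ σ↭ u∈σ)
... | k , k∈ , refl = s≤s z≤n , s≤s (∈-upTo⁻ k∈)

theorem4p1 : (n : ℕ) → 1 ≤ n → (σ : List ℕ) → σ ↭ map suc (upTo n) →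
    (i : ℕ) → 1 ≤ i → i ≤ suc n → (ℓ : Label) → labelAt (Alabeling σ) i ≡ just ℓ →
    wt (insertMax n i σ) · mono ℓ ≡ wt σ · G ℓ
-- The hypotheses 1 ≤ n and i ≤ n + 1 are implied by position i carrying a label.
theorem4p1 n _ [] _ _ _ _ _ ()
theorem4p1 n _ (zero ∷ σ) σ↭ _ _ _ _ _ with ↭-range σ↭ (here refl)
... | () , _
theorem4p1 n _ (suc _ ∷ _) _ zero () _ _ _
-- As σ₁ > 0, the first step of 0σ is an ascent by computation.
theorem4p1 n _ σ@(suc _ ∷ _) σ↭ (suc j) _ _ ℓ ℓ-at-i = begin
  wt π · mono ℓ      ≡⟨ ·-comm (wt π) (mono ℓ) ⟩
  mono ℓ · wt π      ≡⟨ cong (λ D → mono ℓ · weight (labelsOfRuns (runs D))) dirs-π ⟩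
  mono ℓ · weight (labelsOfRuns (runs (insertPeak j (dirs (0 ∷ σ)))))
                     ≡⟨ sym (Substitutes.weight-eq (substitutes-insertPeak (dirs σ) j ℓ ℓ-at-i)) ⟩
  G ℓ · wt σ         ≡⟨ ·-comm (G ℓ) (wt σ) ⟩
  wt σ · G ℓ         ∎
  where
  open ≡-Reasoning
  π : List ℕ
  π = insertMax n (suc j) σ
  dirs-π : dirs (0 ∷ π) ≡ insertPeak j (dirs (0 ∷ σ))
  dirs-π = dirs-insertMax j 0 σ (s≤s z≤n) (All.tabulate (λ u∈σ → proj₂ (↭-range σ↭ u∈σ)))
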